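{- Let $Q$ be a quantale, $M$ and $N$ left $Q$-modules, and $f: M \to N$ a $Q$-module homomorphism with residuum (right adjoint) $f_\ast: N \to M$, and let $\gamma = f_\ast \circ f$. Then the image $M_\gamma = \gamma[M]$ coincides with the set of $\ker f$-saturated elements of $M$, where $\ker f = \{(v,w) \in M\times M \mid f(v) = f(w)\}$.
   Context: A (unital) quantale is a complete lattice with a monoid structure whose product distributes over arbitrary joins in each argument; a left $Q$-module is a complete lattice $M$ with an associative, unital action $Q\times M \to M$ distributing over arbitrary joins in both arguments; a $Q$-module homomorphism is a map preserving arbitrary joins and the action. The residuum of a join-preserving map $f$ is $f_\ast(y) = \bigvee\{x \mid f(x) \leq y\}$. For a relation $R \subseteq M\times M$, $s \in M$ is $R$-saturated if for all $(v,w) \in R$ and $a \in Q$: $a v \leq s \iff a w \leq s$. -}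

module Defs where

open import Level using (Level; suc)
open import Data.Product using (Σ; _×_; _,_; proj₁)
open import Relation.Binary.PropositionalEquality using (_≡_)
open import Relation.Binary.Structures using (IsPartialOrder)
open import Function.Bundles using (_⇔_)

record CompleteLattice (ℓ : Level) : Set (suc ℓ) where
  field
    Carrier        : Set ℓ
    _≤_            : Carrier → Carrier → Set ℓ
    isPartialOrder : IsPartialOrder _≡_ _≤_
    ⋁              : {I : Set ℓ} → (I → Carrier) → Carrier
    ⋁-upper        : {I : Set ℓ} (g : I → Carrier) (i : I) → g i ≤ ⋁ g
    ⋁-least        : {I : Set ℓ} (g : I → Carrier) (u : Carrier) →
                     ((i : I) → g i ≤ u) → ⋁ g ≤ u
  infix 4 _≤_

record Quantale (ℓ : Level) : Set (suc ℓ) where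
  field
    lattice : CompleteLattice ℓ
  open CompleteLattice lattice public
  field
    _·_       : Carrier → Carrier → Carrier
    e         : Carrier
    ·-assoc   : ∀ a b c → (a · b) · c ≡ a · (b · c)
    ·-identityˡ : ∀ a → e · a ≡ a
    ·-identityʳ : ∀ a → a · e ≡ a
    ·-distribˡ-⋁ : ∀ a {I : Set ℓ} (g : I → Carrier) → a · ⋁ g ≡ ⋁ (λ i → a · g i)
    ·-distribʳ-⋁ : ∀ {I : Set ℓ} (g : I → Carrier) a → ⋁ g · a ≡ ⋁ (λ i → g i · a)

record LeftModule {ℓ : Level} (Q : Quantale ℓ) : Set (suc ℓ) where
  private module Q = Quantale Q
  field
    lattice : CompleteLattice ℓ
  open CompleteLattice lattice public
  field
    _∙_        : Q.Carrier → Carrier → Carrier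
    ∙-assoc    : ∀ a b m → (a Q.· b) ∙ m ≡ a ∙ (b ∙ m)
    ∙-identity : ∀ m → Q.e ∙ m ≡ m
    ∙-distribˡ-⋁ : ∀ a {I : Set ℓ} (g : I → Carrier) → a ∙ ⋁ g ≡ ⋁ (λ i → a ∙ g i)
    ∙-distribʳ-⋁ : ∀ {I : Set ℓ} (h : I → Q.Carrier) m → Q.⋁ h ∙ m ≡ ⋁ (λ i → h i ∙ m)

module _ {ℓ : Level} {Q : Quantale ℓ} where
  open Quantale Q using () renaming (Carrier to ∣Q∣)

  record IsHomomorphism (M N : LeftModule Q)
         (f : LeftModule.Carrier M → LeftModule.Carrier N) : Set (suc ℓ) where
    private
      module M = LeftModule M
      module N = LeftModule N
    field
      pres-⋁ : ∀ {I : Set ℓ} (g : I → M.Carrier) → f (M.⋁ g) ≡ N.⋁ (λ i → f (g i))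
      pres-∙ : ∀ (a : ∣Q∣) m → f (a M.∙ m) ≡ a N.∙ f m

  residuum : (M N : LeftModule Q) →
             (LeftModule.Carrier M → LeftModule.Carrier N) →
             LeftModule.Carrier N → LeftModule.Carrier M
  residuum M N f y =
    LeftModule.⋁ M {Σ (LeftModule.Carrier M) (λ x → LeftModule._≤_ N (f x) y)} proj₁

  ker : (M N : LeftModule Q) → (LeftModule.Carrier M → LeftModule.Carrier N) →
        LeftModule.Carrier M → LeftModule.Carrier M → Set ℓ
  ker M N f v w = f v ≡ f w

  Saturated : (M : LeftModule Q) →
              (LeftModule.Carrier M → LeftModule.Carrier M → Set ℓ) →
              LeftModule.Carrier M → Set ℓ
  Saturated M R s = ∀ v w → R v w → ∀ (a : ∣Q∣) →
    (LeftModule._≤_ M (LeftModule._∙_ M a v) s ⇔ LeftModule._≤_ M (LeftModule._∙_ M a w) s)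

InImage : {ℓ : Level} {A B : Set ℓ} → (A → B) → B → Set ℓ
InImage {A = A} g s = Σ A (λ m → g m ≡ s)

-- The residuum makes f ⊣ f_* a Galois connection of Q-modules, so
-- a v ≤ f_* y ⇔ a f(v) ≤ y: every f_* y is ker f-saturated, and
-- in particular so is every element of the image of γ = f_* ∘ f.
-- Conversely, if s is saturated then, since f (γ s) = f s, the pair
-- (γ s, s) lies in ker f and saturation at a = e turns s ≤ s into
-- γ s ≤ s, while s ≤ γ s holds for every s.
module Submission where

open import Defs
open import Level using (Level; Lift; lift)
open import Data.Bool using (true; false)
open import Data.Product using (Σ; _,_; proj₁; proj₂)
open import Function.Base using (_∘_)
open import Function.Bundles using (_⇔_; mk⇔; Equivalence)
open import Function.Properties.Equivalence using (⇔-setoid)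
open import Relation.Binary.PropositionalEquality
  using (_≡_; refl; sym; trans; cong; subst)
open import Relation.Binary.Structures using (IsPartialOrder)
import Relation.Binary.Reasoning.Setoid as ⇔-Reasoning

module _ {ℓ : Level} (L K : CompleteLattice ℓ) where
  private
    module L = CompleteLattice L
    module K = CompleteLattice K
    module LP = IsPartialOrder L.isPartialOrder

  -- x ∨ y is the join of the two-element family indexed by Lift ℓ Bool.
  ⋁-preserving⇒monotone : (f : L.Carrier → K.Carrier) →
    (∀ {I : Set ℓ} (g : I → L.Carrier) → f (L.⋁ g) ≡ K.⋁ (f ∘ g)) →
    ∀ {x y} → x L.≤ y → f x K.≤ f y
  ⋁-preserving⇒monotone f pres-⋁ {x} {y} x≤y =
    subst (f x K.≤_) f⋁≡fy (K.⋁-upper (f ∘ pair) (lift true))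
    where
      pair : Lift ℓ _ → L.Carrier
      pair (lift true)  = x
      pair (lift false) = y

      ⋁pair≡y : L.⋁ pair ≡ y
      ⋁pair≡y = LP.antisym
        (L.⋁-least pair y λ { (lift true) → x≤y ; (lift false) → LP.refl })
        (L.⋁-upper pair (lift false))

      f⋁≡fy : K.⋁ (f ∘ pair) ≡ f y
      f⋁≡fy = trans (sym (pres-⋁ pair)) (cong f ⋁pair≡y)

module _ {ℓ : Level} {Q : Quantale ℓ} (M N : LeftModule Q)
    (f : LeftModule.Carrier M → LeftModule.Carrier N) where
  private
    module M = LeftModule M
    module N = LeftModule N
    module NP = IsPartialOrder N.isPartialOrder

  residuum-adjoint :
    (∀ {I : Set ℓ} (g : I → M.Carrier) → f (M.⋁ g) ≡ N.⋁ (f ∘ g)) →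
    ∀ {x y} → f x N.≤ y ⇔ x M.≤ residuum M N f y
  residuum-adjoint pres-⋁ {x} {y} = mk⇔ unit⁻ (λ x≤f*y → NP.trans (mono x≤f*y) counit)
    where
      Below : Set ℓ
      Below = Σ M.Carrier λ z → f z N.≤ y

      unit⁻ : f x N.≤ y → x M.≤ residuum M N f y
      unit⁻ fx≤y = M.⋁-upper {Below} proj₁ (x , fx≤y)

      counit : f (residuum M N f y) N.≤ y
      counit = subst (N._≤ y) (sym (pres-⋁ {Below} proj₁)) (N.⋁-least _ y proj₂)

      mono : ∀ {u v} → u M.≤ v → f u N.≤ f v
      mono = ⋁-preserving⇒monotone M.lattice N.lattice f pres-⋁

module _ {ℓ : Level} {Q : Quantale ℓ} {M N : LeftModule Q}
    {f : LeftModule.Carrier M → LeftModule.Carrier N}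
    (hom : IsHomomorphism M N f) where
  private
    module Q = Quantale Q
    module M = LeftModule M
    module N = LeftModule N
    module MP = IsPartialOrder M.isPartialOrder
    module NP = IsPartialOrder N.isPartialOrder
    open IsHomomorphism hom

    f* : N.Carrier → M.Carrier
    f* = residuum M N f

    adjoint : ∀ {x y} → f x N.≤ y ⇔ x M.≤ f* y
    adjoint = residuum-adjoint M N f pres-⋁

  ∙-≤-residuum⇔ : ∀ a v y → a M.∙ v M.≤ f* y ⇔ a N.∙ f v N.≤ y
  ∙-≤-residuum⇔ a v y = begin
    a M.∙ v M.≤ f* y    ≈⟨ adjoint ⟨
    f (a M.∙ v) N.≤ y   ≡⟨ cong (N._≤ y) (pres-∙ a v) ⟩
    a N.∙ f v N.≤ y     ∎
    where open ⇔-Reasoning (⇔-setoid ℓ)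

  residuum-saturated : ∀ y → Saturated M (ker M N f) (f* y)
  residuum-saturated y v w fv≡fw a = begin
    a M.∙ v M.≤ f* y    ≈⟨ ∙-≤-residuum⇔ a v y ⟩
    a N.∙ f v N.≤ y     ≡⟨ cong (λ z → a N.∙ z N.≤ y) fv≡fw ⟩
    a N.∙ f w N.≤ y     ≈⟨ ∙-≤-residuum⇔ a w y ⟨
    a M.∙ w M.≤ f* y    ∎
    where open ⇔-Reasoning (⇔-setoid ℓ)

  ≤-residuum-f : ∀ s → s M.≤ f* (f s)
  ≤-residuum-f s = Equivalence.to adjoint NP.refl

  f-residuum-f≡f : ∀ s → f (f* (f s)) ≡ f s
  f-residuum-f≡f s =
    NP.antisym (Equivalence.from adjoint MP.refl)
               (⋁-preserving⇒monotone M.lattice N.lattice f pres-⋁ (≤-residuum-f s))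

  saturated⇒residuum-f-fixed : ∀ s → Saturated M (ker M N f) s → f* (f s) ≡ s
  saturated⇒residuum-f-fixed s sat = MP.antisym γs≤s (≤-residuum-f s)
    where
      e∙≤s⇔ : Q.e M.∙ f* (f s) M.≤ s ⇔ Q.e M.∙ s M.≤ s
      e∙≤s⇔ = sat (f* (f s)) s (f-residuum-f≡f s) Q.e

      γs≤s : f* (f s) M.≤ s
      γs≤s = subst (M._≤ s) (M.∙-identity _)
        (Equivalence.from e∙≤s⇔ (subst (M._≤ s) (sym (M.∙-identity s)) MP.refl))

lemma1p7 : {ℓ : Level} (Q : Quantale ℓ) (M N : LeftModule Q)
           (f : LeftModule.Carrier M → LeftModule.Carrier N) →
           IsHomomorphism M N f →
           (s : LeftModule.Carrier M) →
           InImage (residuum M N f ∘ f) s ⇔ Saturated M (ker M N f) s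
lemma1p7 Q M N f hom s = mk⇔ image⇒saturated saturated⇒image
  where
    image⇒saturated : InImage (residuum M N f ∘ f) s → Saturated M (ker M N f) s
    image⇒saturated (m , refl) = residuum-saturated hom (f m)

    saturated⇒image : Saturated M (ker M N f) s → InImage (residuum M N f ∘ f) s
    saturated⇒image sat = s , saturated⇒residuum-f-fixed hom s sat
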